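{- Let $q>2$ be a prime power, $s\geq 3$ an integer, and let $\Omega$ be a non-empty family of hyperplanes of $\mathrm{PG}(s,q^2)$ such that every point lies in exactly $\frac{q^s(q^{s-1}-(-1)^{s-1})}{q+1}$ or exactly $\frac{q^{s-1}(q^s-(-1)^s)}{q+1}$ hyperplanes of $\Omega$. Then $|\Omega|=\frac{q^s(q^{s+1}+(-1)^s)}{q+1}$. -}

module Defs where

open import Level using (Level; _⊔_) renaming (suc to lsuc)
open import Algebra.Bundles using (CommutativeRing)
open import Data.Nat as ℕ using (ℕ; zero; suc; _^_)
open import Data.Nat.Primality using (Prime)
open import Data.Integer as ℤ using (ℤ; +_; -1ℤ)
open import Data.Fin as Fin using (Fin)
open import Data.List using (List; []; _∷_; length; filter)
open import Data.List.Relation.Unary.Any using (Any)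
open import Data.List.Relation.Unary.AllPairs using (AllPairs)
open import Data.Product using (Σ; ∃; _×_; _,_)
open import Relation.Nullary using (¬_)
open import Relation.Binary using (Decidable)

IsPrimePower : ℕ → Set
IsPrimePower q = Σ ℕ λ p → Σ ℕ λ k → Prime p × (1 ℕ.≤ k) × (q ≡ p ^ k)
  where open import Relation.Binary.PropositionalEquality using (_≡_)

record FiniteField (c ℓ : Level) : Set (lsuc (c ⊔ ℓ)) where
  field
    commRing : CommutativeRing c ℓ
  open CommutativeRing commRing public
  field
    _≟_      : Decidable _≈_
    1≉0      : ¬ (1# ≈ 0#)
    inverse  : ∀ x → ¬ (x ≈ 0#) → ∃ λ y → (x * y) ≈ 1#
    elems    : List Carrier
    complete : ∀ x → Any (x ≈_) elems
    distinct : AllPairs (λ x y → ¬ (x ≈ y)) elems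

  order : ℕ
  order = length elems

module Projective {c ℓ : Level} (F : FiniteField c ℓ) where
  open FiniteField F using (Carrier; _≈_; 0#; _*_; _+_; _≟_)

  -- homogeneous coordinate vectors of PG(s, F) live in F^(s+1)
  Vec : ℕ → Set c
  Vec n = Fin n → Carrier

  NonZero : ∀ {n} → Vec n → Set ℓ
  NonZero {n} v = ¬ (∀ i → v i ≈ 0#)

  Proportional : ∀ {n} → Vec n → Vec n → Set (c ⊔ ℓ)
  Proportional {n} u v = ∃ λ λ' → ∀ i → u i ≈ (λ' * v i)

  dot : ∀ {n} → Vec n → Vec n → Carrier
  dot {ℕ.zero}  a x = 0#
  dot {ℕ.suc n} a x = (a Fin.zero * x Fin.zero) + dot {n} (λ i → a (Fin.suc i)) (λ i → x (Fin.suc i))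

  Incident : ∀ {n} → Vec n → Vec n → Set ℓ
  Incident a x = dot a x ≈ 0#

  countThrough : ∀ {n} → List (Vec n) → Vec n → ℕ
  countThrough Ω x = length (filter (λ a → dot a x ≟ 0#) Ω)

sign : ℕ → ℤ
sign n = -1ℤ ℤ.^ n

{-# OPTIONS --safe #-}
-- Let κ(x) be the number of hyperplanes of Ω through a vector x of F^(s+1), F of order Q = q²,
-- and sum over all Q^(s+1) vectors, the zero vector included. A nonzero linear form has Q^s
-- zeros and two non-proportional ones have Q^(s-1) common zeros (count the zeros of the pencil
-- a + l·b), so Σ κ = |Ω| Q^s and Σ κ² = |Ω| Q^s + |Ω|(|Ω| - 1) Q^(s-1). The product
-- (κ(x)(q+1) - A)(κ(x)(q+1) - B) vanishes at every nonzero x, so its sum is its value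
-- (|Ω|(q+1) - A)(|Ω|(q+1) - B) at the zero vector. This quadratic equation in |Ω|(q+1) has the
-- roots q^s(q^(s+1) + e) and u(qu - e)(q²u - e)/(u - e), where u = q^(s-1) and e = (-1)^s.
-- The second one is not an integer: u - e would divide (q-1)²(q+1), which is smaller than
-- u - e once s ≥ 4, and for s = 3 it would make q² + 1 divide 2(q - 1).
module Submission where

open import Defs
open import Level using (Level)
open import Function using (_∘_)
open import Data.Empty using (⊥-elim)
open import Data.Nat as ℕ using (ℕ; zero; suc; _^_; _<_; _≤_; _∸_; s≤s; z≤n)
import Data.Nat.Properties as ℕₚ
open import Data.Integer as ℤ using (ℤ; +_; 0ℤ; 1ℤ; -1ℤ; _*_; _-_; _+_; -_; ∣_∣)
import Data.Integer.Properties as ℤₚ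
open import Data.Integer.Tactic.RingSolver using (solve-∀)
open import Data.Nat.Tactic.RingSolver using () renaming (solve-∀ to solve-ℕ)
open import Data.Nat.Divisibility using (divides; ∣⇒≤)
open import Algebra.Properties.AbelianGroup ℤₚ.+-0-abelianGroup using () renaming (∙-cancelˡ to +-cancelˡ)
open import Data.Fin using (zero; suc)
open import Data.Fin.Properties using (all?)
open import Data.Vec.Functional using (tail) renaming ([] to []ᵛ; _∷_ to _∷ᵛ_)
open import Data.List using (List; []; _∷_; length; map; _++_; cartesianProductWith)
import Data.List.Relation.Unary.All as All
open import Data.List.Relation.Unary.All using (All; []; _∷_)
open import Data.List.Relation.Unary.Any using (Any; here; there)
open import Data.List.Relation.Unary.AllPairs using (AllPairs; []; _∷_)
open import Data.Product using (∃; _×_; _,_; proj₁; proj₂)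
open import Data.Sum as Sum using (_⊎_; inj₁; inj₂)
open import Relation.Nullary using (¬_; Dec; yes; no)
open import Relation.Binary.PropositionalEquality
  using (_≡_; _≢_; refl; sym; trans; cong; cong₂; subst; subst₂; module ≡-Reasoning)

private
  variable
    a b c p p′ : Level
    A : Set a
    B : Set b
    C : Set c
    P : Set p
    P′ : Set p′

𝟙 : Dec P → ℤ
𝟙 (yes _) = 1ℤ
𝟙 (no _)  = 0ℤ

𝟙-cong : (P → P′) → (P′ → P) → (d : Dec P) (d′ : Dec P′) → 𝟙 d ≡ 𝟙 d′
𝟙-cong _  _    (yes _) (yes _)  = refl
𝟙-cong to _    (yes p) (no ¬p′) = ⊥-elim (¬p′ (to p))
𝟙-cong _  from (no ¬p) (yes p′) = ⊥-elim (¬p (from p′))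
𝟙-cong _  _    (no _)  (no _)   = refl

𝟙-idem : (d : Dec P) → 𝟙 d * 𝟙 d ≡ 𝟙 d
𝟙-idem (yes _) = refl
𝟙-idem (no _)  = refl

∑ : List A → (A → ℤ) → ℤ
∑ []       f = 0ℤ
∑ (x ∷ xs) f = f x + ∑ xs f

∑-cong : ∀ xs {f g : A → ℤ} → (∀ x → f x ≡ g x) → ∑ xs f ≡ ∑ xs g
∑-cong []       _   = refl
∑-cong (x ∷ xs) f≗g = cong₂ _+_ (f≗g x) (∑-cong xs f≗g)

∑-+ : ∀ xs (f g : A → ℤ) → ∑ xs (λ x → f x + g x) ≡ ∑ xs f + ∑ xs g
∑-+ []       f g = refl
∑-+ (x ∷ xs) f g = trans (cong (_+_ (f x + g x)) (∑-+ xs f g)) (interchange (f x) (g x) (∑ xs f) (∑ xs g))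
  where
  interchange : ∀ a b c d → a + b + (c + d) ≡ a + c + (b + d)
  interchange = solve-∀

∑-*ˡ : ∀ xs k (f : A → ℤ) → ∑ xs (λ x → k * f x) ≡ k * ∑ xs f
∑-*ˡ []       k f = sym (ℤₚ.*-zeroʳ k)
∑-*ˡ (x ∷ xs) k f = trans (cong (_+_ (k * f x)) (∑-*ˡ xs k f)) (sym (ℤₚ.*-distribˡ-+ k (f x) (∑ xs f)))

∑-const : ∀ (xs : List A) k → ∑ xs (λ _ → k) ≡ + length xs * k
∑-const []       k = refl
∑-const (x ∷ xs) k = trans (cong (_+_ k) (∑-const xs k)) (sym (ℤₚ.suc-* (+ length xs) k))

∑-zero : ∀ (xs : List A) → ∑ xs (λ _ → 0ℤ) ≡ 0ℤ
∑-zero xs = trans (∑-const xs 0ℤ) (ℤₚ.*-zeroʳ (+ length xs))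

∑-++ : ∀ xs ys (f : A → ℤ) → ∑ (xs ++ ys) f ≡ ∑ xs f + ∑ ys f
∑-++ []       ys f = sym (ℤₚ.+-identityˡ (∑ ys f))
∑-++ (x ∷ xs) ys f = trans (cong (_+_ (f x)) (∑-++ xs ys f)) (sym (ℤₚ.+-assoc (f x) (∑ xs f) (∑ ys f)))

∑-map : ∀ xs (g : A → B) (f : B → ℤ) → ∑ (map g xs) f ≡ ∑ xs (f ∘ g)
∑-map []       g f = refl
∑-map (x ∷ xs) g f = cong (_+_ (f (g x))) (∑-map xs g f)

∑-comm : ∀ xs (ys : List B) (f : A → B → ℤ) → ∑ xs (λ x → ∑ ys (f x)) ≡ ∑ ys (λ y → ∑ xs (λ x → f x y))
∑-comm []       ys f = sym (∑-zero ys)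
∑-comm (x ∷ xs) ys f = trans (cong (_+_ (∑ ys (f x))) (∑-comm xs ys f))
                             (sym (∑-+ ys (f x) (λ y → ∑ xs (λ x′ → f x′ y))))

∑-cartesianProductWith : ∀ (_⊕_ : A → B → C) xs ys f →
  ∑ (cartesianProductWith _⊕_ xs ys) f ≡ ∑ xs (λ x → ∑ ys (λ y → f (x ⊕ y)))
∑-cartesianProductWith _⊕_ []       ys f = refl
∑-cartesianProductWith _⊕_ (x ∷ xs) ys f = begin
  ∑ (map (x ⊕_) ys ++ cartesianProductWith _⊕_ xs ys) f
    ≡⟨ ∑-++ (map (x ⊕_) ys) _ f ⟩
  ∑ (map (x ⊕_) ys) f + ∑ (cartesianProductWith _⊕_ xs ys) f
    ≡⟨ cong₂ _+_ (∑-map ys (x ⊕_) f) (∑-cartesianProductWith _⊕_ xs ys f) ⟩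
  ∑ ys (λ y → f (x ⊕ y)) + ∑ xs (λ x′ → ∑ ys (λ y → f (x′ ⊕ y))) ∎
  where open ≡-Reasoning

-- Σₓ (κ(x) m - A)(κ(x) m - B) evaluated in two ways: at the zero vector alone, and through the
-- moments Σ 1 = Q²P, Σ κ = wQP, Σ κ² = wQP + w(w - 1)P over F^(n+2), where P = Qⁿ.
StandardEquation : (m A B w Q P : ℤ) → Set
StandardEquation m A B w Q P =
  (w * m - A) * (w * m - B) ≡
    m * m * (w * (Q * P) + w * (w - 1ℤ) * P) - m * (A + B) * (w * (Q * P)) + A * B * (Q * (Q * P))

module Counting {c ℓ} (F : FiniteField c ℓ) where

  module F = FiniteField F
  open FiniteField F using (Carrier; _≈_; 0#; _≟_; elems; complete; distinct; order)
  open Projective F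
  open import Algebra.Properties.Group F.+-group using (y≈x\\z; \\-leftDividesˡ; inverseˡ-unique; inverseʳ-unique)
  open import Algebra.Properties.Ring F.ring using (-‿distribˡ-*)
  open import Algebra.Solver.Ring.NaturalCoefficients.Default F.commutativeSemiring using (solve; _:+_; _:*_; _:=_)
  open import Relation.Binary.Reasoning.Setoid F.setoid
    using () renaming (begin_ to ≈-begin_; step-≈-⟩ to step-≈-⟩; _∎ to _≈∎)

  Q : ℤ
  Q = + order

  instance
    Q-nonZero : ℤ.NonZero Q
    Q-nonZero with elems | complete 0#
    ... | _ ∷ _ | _ = _

  IsZero : ∀ {n} → Vec n → Set ℓ
  IsZero x = ∀ i → x i ≈ 0#

  incident? : ∀ {n} (a x : Vec n) → Dec (Incident a x)
  incident? a x = dot a x ≟ 0#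

  vectors : ∀ n → List (Vec n)
  vectors zero    = []ᵛ ∷ []
  vectors (suc n) = cartesianProductWith _∷ᵛ_ elems (vectors n)

  ∑-vectors-suc : ∀ n (f : Vec (suc n) → ℤ) →
    ∑ (vectors (suc n)) f ≡ ∑ elems (λ v → ∑ (vectors n) (λ x → f (v ∷ᵛ x)))
  ∑-vectors-suc n = ∑-cartesianProductWith _∷ᵛ_ elems (vectors n)

  ∑-vectors-const : ∀ n k → ∑ (vectors n) (λ _ → k) ≡ Q ℤ.^ n * k
  ∑-vectors-const zero    k = trans (ℤₚ.+-identityʳ k) (sym (ℤₚ.*-identityˡ k))
  ∑-vectors-const (suc n) k = begin
    ∑ (vectors (suc n)) (λ _ → k)          ≡⟨ ∑-vectors-suc n (λ _ → k) ⟩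
    ∑ elems (λ _ → ∑ (vectors n) (λ _ → k)) ≡⟨ ∑-cong elems (λ _ → ∑-vectors-const n k) ⟩
    ∑ elems (λ _ → Q ℤ.^ n * k)             ≡⟨ ∑-const elems (Q ℤ.^ n * k) ⟩
    Q * (Q ℤ.^ n * k)                       ≡⟨ ℤₚ.*-assoc Q (Q ℤ.^ n) k ⟨
    Q ℤ.^ suc n * k                         ∎
    where open ≡-Reasoning

  ∑-𝟙-absent : ∀ {y} xs → All (λ v → ¬ y ≈ v) xs → ∑ xs (λ v → 𝟙 (y ≟ v)) ≡ 0ℤ
  ∑-𝟙-absent     []       []             = refl
  ∑-𝟙-absent {y} (x ∷ xs) (y≉x ∷ y∉xs) with y ≟ x
  ... | yes y≈x = ⊥-elim (y≉x y≈x)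
  ... | no _    = trans (ℤₚ.+-identityˡ _) (∑-𝟙-absent xs y∉xs)

  ∑-𝟙-unique : ∀ {y} xs → Any (y ≈_) xs → AllPairs (λ u v → ¬ u ≈ v) xs → ∑ xs (λ v → 𝟙 (y ≟ v)) ≡ 1ℤ
  ∑-𝟙-unique {y} (x ∷ xs) y∈x∷xs (x∉xs ∷ xs-distinct) with y ≟ x | y∈x∷xs
  ... | yes y≈x | _         =
    cong (_+_ 1ℤ) (∑-𝟙-absent xs (All.map (λ x≉v y≈v → x≉v (F.trans (F.sym y≈x) y≈v)) x∉xs))
  ... | no y≉x  | here y≈x  = ⊥-elim (y≉x y≈x)
  ... | no _    | there y∈xs = trans (ℤₚ.+-identityˡ _) (∑-𝟙-unique xs y∈xs xs-distinct)

  ∑-𝟙-linear : ∀ {c t} → ¬ c ≈ 0# → ∑ elems (λ v → 𝟙 ((c F.* v) ≟ t)) ≡ 1ℤ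
  ∑-𝟙-linear {c} {t} c≉0 = trans (∑-cong elems (λ v → 𝟙-cong to from ((c F.* v) ≟ t) (c⁻¹t ≟ v)))
                                 (∑-𝟙-unique elems (complete c⁻¹t) distinct)
    where
    c⁻¹ = proj₁ (F.inverse c c≉0)
    cc⁻¹≈1 = proj₂ (F.inverse c c≉0)
    c⁻¹t = c⁻¹ F.* t
    to : ∀ {v} → c F.* v ≈ t → c⁻¹t ≈ v
    to {v} cv≈t = ≈-begin
      c⁻¹ F.* t           ≈⟨ F.*-congˡ (F.sym cv≈t) ⟩
      c⁻¹ F.* (c F.* v)   ≈⟨ F.sym (F.*-assoc c⁻¹ c v) ⟩
      (c⁻¹ F.* c) F.* v   ≈⟨ F.*-congʳ (F.trans (F.*-comm c⁻¹ c) cc⁻¹≈1) ⟩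
      F.1# F.* v          ≈⟨ F.*-identityˡ v ⟩
      v                   ≈∎
    from : ∀ {v} → c⁻¹t ≈ v → c F.* v ≈ t
    from {v} c⁻¹t≈v = ≈-begin
      c F.* v             ≈⟨ F.*-congˡ (F.sym c⁻¹t≈v) ⟩
      c F.* (c⁻¹ F.* t)   ≈⟨ F.sym (F.*-assoc c c⁻¹ t) ⟩
      (c F.* c⁻¹) F.* t   ≈⟨ F.*-congʳ cc⁻¹≈1 ⟩
      F.1# F.* t          ≈⟨ F.*-identityˡ t ⟩
      t                   ≈∎

  dot-zero : ∀ {n} (a x : Vec n) → (∀ i → a i F.* x i ≈ 0#) → dot a x ≈ 0#
  dot-zero {zero}  a x _     = F.refl
  dot-zero {suc n} a x ax≈0 =
    F.trans (F.+-cong (ax≈0 zero) (dot-zero (tail a) (tail x) (ax≈0 ∘ suc))) (F.+-identityʳ 0#)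

  pencil : ∀ {n} → Vec n → Vec n → Carrier → Vec n
  pencil a b l i = a i F.+ l F.* b i

  dot-pencil : ∀ {n} (a b x : Vec n) l → dot (pencil a b l) x ≈ dot a x F.+ l F.* dot b x
  dot-pencil {zero}  a b x l = F.sym (F.trans (F.+-congˡ (F.zeroʳ l)) (F.+-identityʳ 0#))
  dot-pencil {suc n} a b x l = F.trans (F.+-congˡ (dot-pencil (tail a) (tail b) (tail x) l))
    (distrib (a zero) (b zero) (x zero) l (dot (tail a) (tail x)) (dot (tail b) (tail x)))
    where
    distrib : ∀ a₀ b₀ x₀ l A B →
      (a₀ F.+ l F.* b₀) F.* x₀ F.+ (A F.+ l F.* B) ≈ (a₀ F.* x₀ F.+ A) F.+ l F.* (b₀ F.* x₀ F.+ B)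
    distrib = solve 6 (λ a₀ b₀ x₀ l A B →
      (a₀ :+ l :* b₀) :* x₀ :+ (A :+ l :* B) := (a₀ :* x₀ :+ A) :+ l :* (b₀ :* x₀ :+ B)) F.refl

  pencil-nonZero : ∀ {n} {a b : Vec n} l → ¬ Proportional a b → NonZero (pencil a b l)
  pencil-nonZero {a = a} {b} l ¬a∝b a+lb≈0 =
    ¬a∝b (F.- l , λ i → F.trans (inverseˡ-unique (a i) (l F.* b i) (a+lb≈0 i)) (-‿distribˡ-* l (b i)))

  solutions : ∀ {n} → Vec n → Carrier → ℤ
  solutions {n} a t = ∑ (vectors n) (λ x → 𝟙 (dot a x ≟ t))

  solutions-nonZero : ∀ n (a : Vec (suc n)) t → NonZero a → solutions a t ≡ Q ℤ.^ n
  solutions-nonZero n a t a≢0 with all? (λ i → tail a i ≟ 0#)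
  ... | yes tail≈0 = begin
    solutions a t
      ≡⟨ ∑-vectors-suc n _ ⟩
    ∑ elems (λ v → ∑ (vectors n) (λ x → 𝟙 ((a zero F.* v F.+ dot (tail a) x) ≟ t)))
      ≡⟨ ∑-cong elems (λ v → ∑-cong (vectors n) (λ x →
           𝟙-cong (F.trans (F.sym (drop-tail v x))) (F.trans (drop-tail v x)) _ _)) ⟩
    ∑ elems (λ v → ∑ (vectors n) (λ _ → 𝟙 ((a zero F.* v) ≟ t)))
      ≡⟨ ∑-cong elems (λ v → ∑-vectors-const n _) ⟩
    ∑ elems (λ v → Q ℤ.^ n * 𝟙 ((a zero F.* v) ≟ t))
      ≡⟨ ∑-*ˡ elems (Q ℤ.^ n) _ ⟩
    Q ℤ.^ n * ∑ elems (λ v → 𝟙 ((a zero F.* v) ≟ t))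
      ≡⟨ cong (Q ℤ.^ n *_) (∑-𝟙-linear a₀≉0) ⟩
    Q ℤ.^ n * 1ℤ
      ≡⟨ ℤₚ.*-identityʳ (Q ℤ.^ n) ⟩
    Q ℤ.^ n ∎
    where
    open ≡-Reasoning
    a₀≉0 : ¬ a zero ≈ 0#
    a₀≉0 a₀≈0 = a≢0 (λ { zero → a₀≈0 ; (suc i) → tail≈0 i })
    drop-tail : ∀ v x → a zero F.* v F.+ dot (tail a) x ≈ a zero F.* v
    drop-tail v x = F.trans (F.+-congˡ (dot-zero (tail a) x (λ i → F.trans (F.*-congʳ (tail≈0 i)) (F.zeroˡ (x i)))))
                            (F.+-identityʳ _)
  solutions-nonZero zero    a t a≢0 | no tail≉0 = ⊥-elim (tail≉0 (λ ()))
  solutions-nonZero (suc n) a t a≢0 | no tail≉0 = begin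
    solutions a t
      ≡⟨ ∑-vectors-suc (suc n) _ ⟩
    ∑ elems (λ v → ∑ (vectors (suc n)) (λ x → 𝟙 ((a zero F.* v F.+ dot (tail a) x) ≟ t)))
      ≡⟨ ∑-cong elems (λ v → ∑-cong (vectors (suc n)) (λ x →
           𝟙-cong (y≈x\\z _ _ _) (λ e → F.trans (F.+-congˡ e) (\\-leftDividesˡ _ _)) _ _)) ⟩
    ∑ elems (λ v → solutions (tail a) (F.- (a zero F.* v) F.+ t))
      ≡⟨ ∑-cong elems (λ v → solutions-nonZero n (tail a) _ tail≉0) ⟩
    ∑ elems (λ _ → Q ℤ.^ n)
      ≡⟨ ∑-const elems (Q ℤ.^ n) ⟩
    Q ℤ.^ suc n ∎
    where open ≡-Reasoning

  -- If b·x ≉ 0 then x lies on exactly one hyperplane a + l·b; otherwise on all or none of them.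
  pencilIncidence : ∀ {n} (a b x : Vec n) →
    ∑ elems (λ l → 𝟙 (incident? (pencil a b l) x)) + 𝟙 (incident? b x)
      ≡ 1ℤ + Q * (𝟙 (incident? a x) * 𝟙 (incident? b x))
  pencilIncidence a b x with incident? b x
  ... | yes b·x≈0 = begin
    ∑ elems (λ l → 𝟙 (incident? (pencil a b l) x)) + 1ℤ
      ≡⟨ cong₂ _+_ (∑-cong elems (λ l → 𝟙-cong (F.trans (F.sym (on-a l))) (F.trans (on-a l)) _ _)) refl ⟩
    ∑ elems (λ _ → 𝟙 (incident? a x)) + 1ℤ
      ≡⟨ cong₂ _+_ (∑-const elems _) refl ⟩
    Q * 𝟙 (incident? a x) + 1ℤ
      ≡⟨ rearrange Q (𝟙 (incident? a x)) ⟩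
    1ℤ + Q * (𝟙 (incident? a x) * 1ℤ) ∎
    where
    open ≡-Reasoning
    on-a : ∀ l → dot (pencil a b l) x ≈ dot a x
    on-a l = F.trans (dot-pencil a b x l) (F.trans (F.+-congˡ (F.trans (F.*-congˡ b·x≈0) (F.zeroʳ l))) (F.+-identityʳ _))
    rearrange : ∀ Q i → Q * i + 1ℤ ≡ 1ℤ + Q * (i * 1ℤ)
    rearrange = solve-∀
  ... | no b·x≉0 = begin
    ∑ elems (λ l → 𝟙 (incident? (pencil a b l) x)) + 0ℤ
      ≡⟨ ℤₚ.+-identityʳ _ ⟩
    ∑ elems (λ l → 𝟙 (incident? (pencil a b l) x))
      ≡⟨ ∑-cong elems (λ l → 𝟙-cong (to l) (from l) _ _) ⟩
    ∑ elems (λ l → 𝟙 ((dot b x F.* l) ≟ (F.- dot a x)))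
      ≡⟨ ∑-𝟙-linear b·x≉0 ⟩
    1ℤ
      ≡⟨ rearrange Q (𝟙 (incident? a x)) ⟩
    1ℤ + Q * (𝟙 (incident? a x) * 0ℤ) ∎
    where
    open ≡-Reasoning
    to : ∀ l → dot (pencil a b l) x ≈ 0# → dot b x F.* l ≈ F.- dot a x
    to l eq = F.trans (F.*-comm _ _) (inverseʳ-unique _ _ (F.trans (F.sym (dot-pencil a b x l)) eq))
    from : ∀ l → dot b x F.* l ≈ F.- dot a x → dot (pencil a b l) x ≈ 0#
    from l eq = F.trans (dot-pencil a b x l) (F.trans (F.+-congˡ (F.trans (F.*-comm _ _) eq)) (F.-‿inverseʳ _))
    rearrange : ∀ Q i → 1ℤ ≡ 1ℤ + Q * (i * 0ℤ)
    rearrange = solve-∀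

  commonZeros : ∀ n {a b : Vec (suc (suc n))} → NonZero b → ¬ Proportional a b →
    ∑ (vectors (suc (suc n))) (λ x → 𝟙 (incident? a x) * 𝟙 (incident? b x)) ≡ Q ℤ.^ n
  commonZeros n {a} {b} b≢0 ¬a∝b = sym (ℤₚ.*-cancelˡ-≡ Q _ _ (+-cancelˡ (Q * Q ℤ.^ suc n) _ _ doubleCount))
    where
    open ≡-Reasoning
    V = vectors (suc (suc n))
    doubleCount : Q * Q ℤ.^ suc n + Q ℤ.^ suc n
                  ≡ Q * Q ℤ.^ suc n + Q * ∑ V (λ x → 𝟙 (incident? a x) * 𝟙 (incident? b x))
    doubleCount = begin
      Q * Q ℤ.^ suc n + Q ℤ.^ suc n
        ≡⟨ cong₂ _+_ (sym (∑-const elems _)) refl ⟩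
      ∑ elems (λ _ → Q ℤ.^ suc n) + Q ℤ.^ suc n
        ≡⟨ sym (cong₂ _+_ (∑-cong elems (λ l → solutions-nonZero (suc n) (pencil a b l) 0# (pencil-nonZero l ¬a∝b)))
                          (solutions-nonZero (suc n) b 0# b≢0)) ⟩
      ∑ elems (λ l → solutions (pencil a b l) 0#) + solutions b 0#
        ≡⟨ cong₂ _+_ (sym (∑-comm V elems _)) refl ⟩
      ∑ V (λ x → ∑ elems (λ l → 𝟙 (incident? (pencil a b l) x))) + ∑ V (λ x → 𝟙 (incident? b x))
        ≡⟨ sym (∑-+ V _ _) ⟩
      ∑ V (λ x → ∑ elems (λ l → 𝟙 (incident? (pencil a b l) x)) + 𝟙 (incident? b x))
        ≡⟨ ∑-cong V (pencilIncidence a b) ⟩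
      ∑ V (λ x → 1ℤ + Q * (𝟙 (incident? a x) * 𝟙 (incident? b x)))
        ≡⟨ ∑-+ V _ _ ⟩
      ∑ V (λ _ → 1ℤ) + ∑ V (λ x → Q * (𝟙 (incident? a x) * 𝟙 (incident? b x)))
        ≡⟨ cong₂ _+_ (trans (∑-vectors-const (suc (suc n)) 1ℤ) (ℤₚ.*-identityʳ (Q ℤ.^ suc (suc n))))
                     (∑-*ˡ V Q (λ x → 𝟙 (incident? a x) * 𝟙 (incident? b x))) ⟩
      Q * Q ℤ.^ suc n + Q * ∑ V (λ x → 𝟙 (incident? a x) * 𝟙 (incident? b x)) ∎

  countThrough-∷ : ∀ {n} a (Ω : List (Vec n)) x → + countThrough (a ∷ Ω) x ≡ 𝟙 (incident? a x) + + countThrough Ω x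
  countThrough-∷ a Ω x with incident? a x
  ... | yes _ = refl
  ... | no _  = refl

  countThrough-zero : ∀ {n} (Ω : List (Vec n)) x → IsZero x → countThrough Ω x ≡ length Ω
  countThrough-zero []      x x≈0 = refl
  countThrough-zero (a ∷ Ω) x x≈0 with incident? a x
  ... | yes _      = cong suc (countThrough-zero Ω x x≈0)
  ... | no a·x≉0 = ⊥-elim (a·x≉0 (dot-zero a x (λ i → F.trans (F.*-congˡ (x≈0 i)) (F.zeroʳ (a i)))))

  ∑-countThrough : ∀ n (Ω : List (Vec (suc n))) → All NonZero Ω →
    ∑ (vectors (suc n)) (λ x → + countThrough Ω x) ≡ + length Ω * Q ℤ.^ n
  ∑-countThrough n []      []            = ∑-zero (vectors (suc n))
  ∑-countThrough n (a ∷ Ω) (a≢0 ∷ Ω≢0) = begin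
    ∑ V (λ x → + countThrough (a ∷ Ω) x)
      ≡⟨ ∑-cong V (countThrough-∷ a Ω) ⟩
    ∑ V (λ x → 𝟙 (incident? a x) + + countThrough Ω x)
      ≡⟨ ∑-+ V _ _ ⟩
    solutions a 0# + ∑ V (λ x → + countThrough Ω x)
      ≡⟨ cong₂ _+_ (solutions-nonZero n a 0# a≢0) (∑-countThrough n Ω Ω≢0) ⟩
    Q ℤ.^ n + + length Ω * Q ℤ.^ n
      ≡⟨ ℤₚ.suc-* (+ length Ω) (Q ℤ.^ n) ⟨
    + length (a ∷ Ω) * Q ℤ.^ n ∎
    where
    open ≡-Reasoning
    V = vectors (suc n)

  ∑-incident*countThrough : ∀ n {a} (Ω : List (Vec (suc (suc n)))) → All NonZero Ω → All (λ b → ¬ Proportional a b) Ω →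
    ∑ (vectors (suc (suc n))) (λ x → 𝟙 (incident? a x) * + countThrough Ω x) ≡ + length Ω * Q ℤ.^ n
  ∑-incident*countThrough n {a} [] [] [] =
    trans (∑-cong (vectors (suc (suc n))) (λ x → ℤₚ.*-zeroʳ (𝟙 (incident? a x)))) (∑-zero (vectors (suc (suc n))))
  ∑-incident*countThrough n {a} (b ∷ Ω) (b≢0 ∷ Ω≢0) (¬a∝b ∷ ¬a∝Ω) = begin
    ∑ V (λ x → 𝟙 (incident? a x) * + countThrough (b ∷ Ω) x)
      ≡⟨ ∑-cong V (λ x → trans (cong (𝟙 (incident? a x) *_) (countThrough-∷ b Ω x))
                               (ℤₚ.*-distribˡ-+ (𝟙 (incident? a x)) _ _)) ⟩
    ∑ V (λ x → 𝟙 (incident? a x) * 𝟙 (incident? b x) + 𝟙 (incident? a x) * + countThrough Ω x)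
      ≡⟨ ∑-+ V _ _ ⟩
    ∑ V (λ x → 𝟙 (incident? a x) * 𝟙 (incident? b x)) + ∑ V (λ x → 𝟙 (incident? a x) * + countThrough Ω x)
      ≡⟨ cong₂ _+_ (commonZeros n b≢0 ¬a∝b) (∑-incident*countThrough n Ω Ω≢0 ¬a∝Ω) ⟩
    Q ℤ.^ n + + length Ω * Q ℤ.^ n
      ≡⟨ ℤₚ.suc-* (+ length Ω) (Q ℤ.^ n) ⟨
    + length (b ∷ Ω) * Q ℤ.^ n ∎
    where
    open ≡-Reasoning
    V = vectors (suc (suc n))

  ∑-countThrough² : ∀ n (Ω : List (Vec (suc (suc n)))) → All NonZero Ω → AllPairs (λ a b → ¬ Proportional a b) Ω →
    let w = + length Ω in
    ∑ (vectors (suc (suc n))) (λ x → + countThrough Ω x * + countThrough Ω x) ≡ w * Q ℤ.^ suc n + w * (w - 1ℤ) * Q ℤ.^ n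
  ∑-countThrough² n []      []            []               = ∑-zero (vectors (suc (suc n)))
  ∑-countThrough² n (a ∷ Ω) (a≢0 ∷ Ω≢0) (¬a∝Ω ∷ Ω-indep) = begin
    ∑ V (λ x → κ⁺ x * κ⁺ x)
      ≡⟨ ∑-cong V (λ x → trans (cong (λ y → y * y) (countThrough-∷ a Ω x)) (square (incident? a x) (κ x))) ⟩
    ∑ V (λ x → χ x + (+ 2 * (χ x * κ x) + κ x * κ x))
      ≡⟨ ∑-+ V χ _ ⟩
    ∑ V χ + ∑ V (λ x → + 2 * (χ x * κ x) + κ x * κ x)
      ≡⟨ cong (_+_ (∑ V χ)) (trans (∑-+ V _ (λ x → κ x * κ x))
                                  (cong₂ _+_ (∑-*ˡ V (+ 2) (λ x → χ x * κ x)) refl)) ⟩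
    solutions a 0# + (+ 2 * ∑ V (λ x → χ x * κ x) + ∑ V (λ x → κ x * κ x))
      ≡⟨ cong₂ _+_ (solutions-nonZero (suc n) a 0# a≢0)
                   (cong₂ _+_ (cong (_*_ (+ 2)) (∑-incident*countThrough n Ω Ω≢0 ¬a∝Ω))
                              (∑-countThrough² n Ω Ω≢0 Ω-indep)) ⟩
    Q * X + (+ 2 * (w * X) + (w * (Q * X) + w * (w - 1ℤ) * X))
      ≡⟨ collect Q X w ⟩
    (1ℤ + w) * (Q * X) + (1ℤ + w) * (1ℤ + w - 1ℤ) * X ∎
    where
    open ≡-Reasoning
    V = vectors (suc (suc n))
    w = + length Ω
    X = Q ℤ.^ n
    κ κ⁺ : Vec (suc (suc n)) → ℤ
    κ x = + countThrough Ω x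
    χ : Vec (suc (suc n)) → ℤ
    χ x = 𝟙 (incident? a x)
    κ⁺ x = + countThrough (a ∷ Ω) x
    square : ∀ {p} {P : Set p} (d : Dec P) y → (𝟙 d + y) * (𝟙 d + y) ≡ 𝟙 d + (+ 2 * (𝟙 d * y) + y * y)
    square d y = trans (expand (𝟙 d) y) (cong₂ _+_ (𝟙-idem d) refl)
      where
      expand : ∀ i y → (i + y) * (i + y) ≡ i * i + (+ 2 * (i * y) + y * y)
      expand = solve-∀
    collect : ∀ Q X w → Q * X + (+ 2 * (w * X) + (w * (Q * X) + w * (w - 1ℤ) * X))
                        ≡ (1ℤ + w) * (Q * X) + (1ℤ + w) * (1ℤ + w - 1ℤ) * X
    collect = solve-∀

  ∑-concentratedAtZero : ∀ n (g : Vec n → ℤ) {k} →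
    (∀ x → NonZero x → g x ≡ 0ℤ) → (∀ x → IsZero x → g x ≡ k) →
    ∑ (vectors n) g ≡ k
  ∑-concentratedAtZero zero    g g≢0 g≈0 = trans (ℤₚ.+-identityʳ (g []ᵛ)) (g≈0 []ᵛ (λ ()))
  ∑-concentratedAtZero (suc n) g {k} g≢0 g≈0 = begin
    ∑ (vectors (suc n)) g                              ≡⟨ ∑-vectors-suc n g ⟩
    ∑ elems (λ v → ∑ (vectors n) (λ x → g (v ∷ᵛ x))) ≡⟨ ∑-cong elems slice ⟩
    ∑ elems (λ v → k * 𝟙 (0# ≟ v))                    ≡⟨ ∑-*ˡ elems k _ ⟩
    k * ∑ elems (λ v → 𝟙 (0# ≟ v))                    ≡⟨ cong (k *_) (∑-𝟙-unique elems (complete 0#) distinct) ⟩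
    k * 1ℤ                                             ≡⟨ ℤₚ.*-identityʳ k ⟩
    k                                                  ∎
    where
    open ≡-Reasoning
    slice : ∀ v → ∑ (vectors n) (λ x → g (v ∷ᵛ x)) ≡ k * 𝟙 (0# ≟ v)
    slice v with 0# ≟ v
    ... | yes 0≈v = trans (∑-concentratedAtZero n (g ∘ (v ∷ᵛ_))
                            (λ x x≢0 → g≢0 (v ∷ᵛ x) (λ v∷x≈0 → x≢0 (v∷x≈0 ∘ suc)))
                            (λ x x≈0 → g≈0 (v ∷ᵛ x) (λ { zero → F.sym 0≈v ; (suc i) → x≈0 i })))
                          (sym (ℤₚ.*-identityʳ k))
    ... | no 0≉v  = trans (∑-cong (vectors n) (λ x → g≢0 (v ∷ᵛ x) (λ v∷x≈0 → 0≉v (F.sym (v∷x≈0 zero)))))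
                          (trans (∑-zero (vectors n)) (sym (ℤₚ.*-zeroʳ k)))

  standardEquation : ∀ n (Ω : List (Vec (suc (suc n)))) → All NonZero Ω → AllPairs (λ a b → ¬ Proportional a b) Ω →
    ∀ m A B → (∀ x → NonZero x → + countThrough Ω x * m ≡ A ⊎ + countThrough Ω x * m ≡ B) →
    StandardEquation m A B (+ length Ω) Q (Q ℤ.^ n)
  standardEquation n Ω Ω≢0 Ω-indep m A B twoValues = begin
    (w * m - A) * (w * m - B)
      ≡⟨ ∑-concentratedAtZero _ g vanishes atZero ⟨
    ∑ V g
      ≡⟨ ∑-cong V (λ x → expand (κ x) m A B) ⟩
    ∑ V (λ x → m * m * (κ x * κ x) + - (m * (A + B)) * κ x + A * B)
      ≡⟨ trans (∑-+ V _ (λ _ → A * B)) (cong₂ _+_ (∑-+ V _ _) (∑-vectors-const (suc (suc n)) (A * B))) ⟩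
    ∑ V (λ x → m * m * (κ x * κ x)) + ∑ V (λ x → - (m * (A + B)) * κ x) + Q ℤ.^ suc (suc n) * (A * B)
      ≡⟨ cong₂ _+_ (cong₂ _+_ (∑-*ˡ V (m * m) _) (∑-*ˡ V (- (m * (A + B))) κ)) refl ⟩
    m * m * ∑ V (λ x → κ x * κ x) + - (m * (A + B)) * ∑ V κ + Q ℤ.^ suc (suc n) * (A * B)
      ≡⟨ cong₂ _+_ (cong₂ _+_ (cong (m * m *_) (∑-countThrough² n Ω Ω≢0 Ω-indep))
                              (cong (- (m * (A + B)) *_) (∑-countThrough (suc n) Ω Ω≢0))) refl ⟩
    m * m * (w * (Q * Qⁿ) + w * (w - 1ℤ) * Qⁿ) + - (m * (A + B)) * (w * (Q * Qⁿ)) + Q * (Q * Qⁿ) * (A * B)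
      ≡⟨ rearrange m A B w Q Qⁿ ⟩
    m * m * (w * (Q * Qⁿ) + w * (w - 1ℤ) * Qⁿ) - m * (A + B) * (w * (Q * Qⁿ)) + A * B * (Q * (Q * Qⁿ)) ∎
    where
    open ≡-Reasoning
    V = vectors (suc (suc n))
    w = + length Ω
    Qⁿ = Q ℤ.^ n
    κ : Vec (suc (suc n)) → ℤ
    κ x = + countThrough Ω x
    g : Vec (suc (suc n)) → ℤ
    g x = (κ x * m - A) * (κ x * m - B)
    vanishes : ∀ x → NonZero x → g x ≡ 0ℤ
    vanishes x x≢0 with twoValues x x≢0
    ... | inj₁ κm≡A = trans (cong (λ y → (y - A) * (y - B)) κm≡A) (cong (_* (A - B)) (ℤₚ.+-inverseʳ A))
    ... | inj₂ κm≡B = trans (cong (λ y → (y - A) * (y - B)) κm≡B)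
                            (trans (cong ((B - A) *_) (ℤₚ.+-inverseʳ B)) (ℤₚ.*-zeroʳ (B - A)))
    atZero : ∀ x → IsZero x → g x ≡ (w * m - A) * (w * m - B)
    atZero x x≈0 = cong (λ y → (+ y * m - A) * (+ y * m - B)) (countThrough-zero Ω x x≈0)
    expand : ∀ y m A B → (y * m - A) * (y * m - B) ≡ m * m * (y * y) + - (m * (A + B)) * y + A * B
    expand = solve-∀
    rearrange : ∀ m A B w Q P →
      m * m * (w * (Q * P) + w * (w - 1ℤ) * P) + - (m * (A + B)) * (w * (Q * P)) + Q * (Q * P) * (A * B)
        ≡ m * m * (w * (Q * P) + w * (w - 1ℤ) * P) - m * (A + B) * (w * (Q * P)) + A * B * (Q * (Q * P))
    rearrange = solve-∀

sign-±1 : ∀ n → sign n ≡ 1ℤ ⊎ sign n ≡ -1ℤ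
sign-±1 zero    = inj₁ refl
sign-±1 (suc n) = Sum.swap (Sum.map (cong (-1ℤ *_)) (cong (-1ℤ *_)) (sign-±1 n))

∣±1∣≡1 : ∀ {e} → e ≡ 1ℤ ⊎ e ≡ -1ℤ → ∣ e ∣ ≡ 1
∣±1∣≡1 (inj₁ refl) = refl
∣±1∣≡1 (inj₂ refl) = refl

0<∣r∣<∣d∣⇒d*k≢r : ∀ d k r → 0 < ∣ r ∣ → ∣ r ∣ < ∣ d ∣ → d * k ≢ r
0<∣r∣<∣d∣⇒d*k≢r d k _ 0<∣dk∣ ∣dk∣<∣d∣ refl =
  ℕₚ.<⇒≱ ∣dk∣<∣d∣
    (∣⇒≤ {{ℕ.>-nonZero 0<∣dk∣}} (divides ∣ k ∣ (trans (ℤₚ.abs-* d k) (ℕₚ.*-comm ∣ d ∣ ∣ k ∣))))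

pos-^2 : ∀ q → + (q ^ 2) ≡ + q * + q
pos-^2 q = trans (cong (λ x → + (q ℕ.* x)) (ℕₚ.*-identityʳ q)) (ℤₚ.pos-* q q)

u+e≢0 : ∀ {e} → e ≡ 1ℤ ⊎ e ≡ -1ℤ → ∀ u → 2 ≤ u → + u + e ≢ 0ℤ
u+e≢0 (inj₁ refl) _ (s≤s (s≤s _)) ()
u+e≢0 (inj₂ refl) _ (s≤s (s≤s _)) ()

2≤q^[1+k] : ∀ q k → 2 ≤ q → 2 ≤ q ^ suc k
2≤q^[1+k] q k 2≤q =
  ℕₚ.≤-trans 2≤q (ℕₚ.m≤m*n q (q ^ k) {{ℕₚ.m^n≢0 q k {{ℕ.>-nonZero (ℕₚ.<-≤-trans ℕ.z<s 2≤q)}}}})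

pos-square-^ : ∀ q k → (+ q * + q) ℤ.^ k ≡ + (q ^ k) * + (q ^ k)
pos-square-^ q zero    = refl
pos-square-^ q (suc k) = begin
  + q * + q * (+ q * + q) ℤ.^ k        ≡⟨ cong (_*_ (+ q * + q)) (pos-square-^ q k) ⟩
  + q * + q * (+ (q ^ k) * + (q ^ k))  ≡⟨ interchange (+ q) (+ (q ^ k)) ⟩
  + q * + (q ^ k) * (+ q * + (q ^ k))  ≡⟨ sym (cong₂ _*_ (ℤₚ.pos-* q (q ^ k)) (ℤₚ.pos-* q (q ^ k))) ⟩
  + (q ^ suc k) * + (q ^ suc k)        ∎
  where
  open ≡-Reasoning
  interchange : ∀ a b → a * a * (b * b) ≡ a * b * (a * b)
  interchange = solve-∀

factorisation : ∀ {e} → e ≡ 1ℤ ⊎ e ≡ -1ℤ → ∀ q u w →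
  (1ℤ + q) * (1ℤ + q) * (w * (q * q * (u * u)) + w * (w - 1ℤ) * (u * u))
    - (1ℤ + q) * (q * u * (u + e) + u * (q * u - e)) * (w * (q * q * (u * u)))
    + q * u * (u + e) * (u * (q * u - e)) * (q * q * (q * q * (u * u)))
    - (w * (1ℤ + q) - q * u * (u + e)) * (w * (1ℤ + q) - u * (q * u - e))
  ≡ (u + e) * (w * (1ℤ + q) - q * u * (q * (q * u) + e))
      * ((u - e) * (w * (1ℤ + q)) - u * (q * u - e) * (q * (q * u) - e))
factorisation (inj₁ refl) = solve-∀
factorisation (inj₂ refl) = solve-∀

standardEquation-roots : ∀ {e} → e ≡ 1ℤ ⊎ e ≡ -1ℤ → ∀ q u w → u + e ≢ 0ℤ →
  StandardEquation (1ℤ + q) (q * u * (u + e)) (u * (q * u - e)) w (q * q) (u * u) →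
  w * (1ℤ + q) ≡ q * u * (q * (q * u) + e) ⊎
  (u - e) * (w * (1ℤ + q)) ≡ u * (q * u - e) * (q * (q * u) - e)
standardEquation-roots e≡±1 q u w u+e≢0 equation
  with ℤₚ.i*j≡0⇒i≡0∨j≡0 _ (trans (sym (factorisation e≡±1 q u w)) (ℤₚ.i≡j⇒i-j≡0 (sym equation)))
... | inj₂ secondRoot = inj₂ (ℤₚ.i-j≡0⇒i≡j _ _ secondRoot)
... | inj₁ product≡0 with ℤₚ.i*j≡0⇒i≡0∨j≡0 _ product≡0
...   | inj₁ u+e≡0   = ⊥-elim (u+e≢0 u+e≡0)
...   | inj₂ firstRoot = inj₁ (ℤₚ.i-j≡0⇒i≡j _ _ firstRoot)

-- u ≡ e modulo u - e, hence u(qu - e)(q²u - e) ≡ e(q - 1)²(q + 1).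
secondRoot-divisibility : ∀ {e} → e ≡ 1ℤ ⊎ e ≡ -1ℤ → ∀ q U W →
  (U - e) * W ≡ U * (q * U - e) * (q * (q * U) - e) → ∃ λ k → (U - e) * k ≡ e * ((q - 1ℤ) * (q - 1ℤ) * (q + 1ℤ))
secondRoot-divisibility {e} e≡±1 q U W secondRoot =
  _ , trans (division e≡±1 q U W) (trans (cong (_+_ (e * r)) (ℤₚ.i≡j⇒i-j≡0 secondRoot)) (ℤₚ.+-identityʳ (e * r)))
  where
  r = (q - 1ℤ) * (q - 1ℤ) * (q + 1ℤ)
  division : ∀ {e} → e ≡ 1ℤ ⊎ e ≡ -1ℤ → ∀ q U W →
    (U - e) * (W - (q * q * q * (U * U + e * U + 1ℤ) - q * (q + 1ℤ) * e * (U + e) + 1ℤ))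
      ≡ e * ((q - 1ℤ) * (q - 1ℤ) * (q + 1ℤ)) + ((U - e) * W - U * (q * U - e) * (q * (q * U) - e))
  division (inj₁ refl) = solve-∀
  division (inj₂ refl) = solve-∀

-- Modulo q² + 1 one has q² ≡ -1, so q²(q³ + 1)(q⁴ + 1) ≡ 2(q - 1).
secondRoot-divisibility-u≡q² : ∀ q W → (q * q + 1ℤ) * W ≡ q * q * (q * (q * q) + 1ℤ) * (q * (q * (q * q)) + 1ℤ) →
  ∃ λ k → (q * q + 1ℤ) * k ≡ + 2 * (q - 1ℤ)
secondRoot-divisibility-u≡q² q W secondRoot =
  _ , trans (division q W) (trans (cong (_+_ (+ 2 * (q - 1ℤ))) (ℤₚ.i≡j⇒i-j≡0 secondRoot)) (ℤₚ.+-identityʳ _))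
  where
  division : ∀ q W →
    (q * q + 1ℤ) * (W - (q * q * q * q * q * q * q - q * q * q * q * q + q * q * q * q + + 2 * (q * q * q) - q * q - + 2 * q + + 2))
      ≡ + 2 * (q - 1ℤ) + ((q * q + 1ℤ) * W - q * q * (q * (q * q) + 1ℤ) * (q * (q * (q * q)) + 1ℤ))
  division = solve-∀

secondRoot-excluded-u≥q³ : ∀ {e} → e ≡ 1ℤ ⊎ e ≡ -1ℤ → ∀ q U W → 2 ≤ q → q ^ 3 ≤ ∣ U ∣ →
  (U - e) * W ≢ U * (+ q * U - e) * (+ q * (+ q * U) - e)
secondRoot-excluded-u≥q³ {e} e≡±1 (suc (suc p)) U W (s≤s (s≤s z≤n)) q³≤∣U∣ secondRoot =
  0<∣r∣<∣d∣⇒d*k≢r (U - e) (proj₁ quotient) (e * r) (subst (0 <_) (sym ∣er∣≡R) ℕ.z<s)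
                  (subst (_< ∣ U - e ∣) (sym ∣er∣≡R) R<∣U-e∣) (proj₂ quotient)
  where
  q = + suc (suc p)
  r = (q - 1ℤ) * (q - 1ℤ) * (q + 1ℤ)
  R = suc p ℕ.* suc p ℕ.* (suc (suc p) ℕ.+ 1)
  quotient = secondRoot-divisibility e≡±1 q U W secondRoot
  ∣er∣≡R : ∣ e * r ∣ ≡ R
  ∣er∣≡R = begin
    ∣ e * r ∣         ≡⟨ ℤₚ.abs-* e r ⟩
    ∣ e ∣ ℕ.* ∣ r ∣   ≡⟨ cong (ℕ._* ∣ r ∣) (∣±1∣≡1 e≡±1) ⟩
    1 ℕ.* ∣ r ∣       ≡⟨ ℕₚ.*-identityˡ ∣ r ∣ ⟩
    ∣ r ∣             ≡⟨ cong ∣_∣ (trans (cong (_* (q + 1ℤ)) (sym (ℤₚ.pos-* (suc p) (suc p))))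
                                      (sym (ℤₚ.pos-* (suc p ℕ.* suc p) _))) ⟩
    R                 ∎
    where open ≡-Reasoning
  ∣U∣≤1+∣U-e∣ : ∣ U ∣ ≤ suc ∣ U - e ∣
  ∣U∣≤1+∣U-e∣ = subst₂ _≤_ (cong ∣_∣ (e+[U-e]≡U e U)) (cong (ℕ._+ ∣ U - e ∣) (∣±1∣≡1 e≡±1))
                          (ℤₚ.∣i+j∣≤∣i∣+∣j∣ e (U - e))
    where
    e+[U-e]≡U : ∀ e U → e + (U - e) ≡ U
    e+[U-e]≡U = solve-∀
  R<∣U-e∣ : R < ∣ U - e ∣
  R<∣U-e∣ = ℕ.s≤s⁻¹ (ℕₚ.≤-trans (cube-bound p) (ℕₚ.≤-trans q³≤∣U∣ ∣U∣≤1+∣U-e∣))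
    where
    cube-bound : ∀ p → 2 ℕ.+ suc p ℕ.* suc p ℕ.* (suc (suc p) ℕ.+ 1) ≤ suc (suc p) ^ 3
    cube-bound p = ℕₚ.≤-trans (ℕₚ.m≤m+n _ (p ℕ.* p ℕ.+ 5 ℕ.* p ℕ.+ 3)) (ℕₚ.≤-reflexive (expand p))
      where
      expand : ∀ p → 2 ℕ.+ suc p ℕ.* suc p ℕ.* (suc (suc p) ℕ.+ 1) ℕ.+ (p ℕ.* p ℕ.+ 5 ℕ.* p ℕ.+ 3)
                     ≡ suc (suc p) ℕ.* (suc (suc p) ℕ.* (suc (suc p) ℕ.* 1))
      expand = solve-ℕ

secondRoot-excluded-u≡q² : ∀ q W → 2 ≤ q →
  let U = + q * + q in (U + 1ℤ) * W ≢ U * (+ q * U + 1ℤ) * (+ q * (+ q * U) + 1ℤ)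
secondRoot-excluded-u≡q² q W 2≤q secondRoot =
  0<∣r∣<∣d∣⇒d*k≢r (+ q * + q + 1ℤ) (proj₁ quotient) (+ 2 * (+ q - 1ℤ))
    (subst (0 <_) (sym ∣r∣≡) (proj₁ (bounds 2≤q))) (subst₂ _<_ (sym ∣r∣≡) (sym ∣d∣≡) (proj₂ (bounds 2≤q)))
    (proj₂ quotient)
  where
  quotient = secondRoot-divisibility-u≡q² (+ q) W secondRoot
  ∣r∣≡ : ∣ + 2 * (+ q - 1ℤ) ∣ ≡ 2 ℕ.* (q ∸ 1)
  ∣r∣≡ = cong ∣_∣ (trans (cong (_*_ (+ 2)) (ℤₚ.⊖-≥ (ℕₚ.≤-trans (s≤s z≤n) 2≤q)))
                         (sym (ℤₚ.pos-* 2 (q ∸ 1))))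
  ∣d∣≡ : ∣ + q * + q + 1ℤ ∣ ≡ q ℕ.* q ℕ.+ 1
  ∣d∣≡ = cong (λ x → ∣ x + 1ℤ ∣) (sym (ℤₚ.pos-* q q))
  bounds : ∀ {q} → 2 ≤ q → 0 < 2 ℕ.* (q ∸ 1) × 2 ℕ.* (q ∸ 1) < q ℕ.* q ℕ.+ 1
  bounds {suc (suc p)} (s≤s (s≤s z≤n)) =
    ℕ.z<s , ℕₚ.≤-trans (ℕₚ.m≤m+n _ (p ℕ.* p ℕ.+ 2 ℕ.* p ℕ.+ 2)) (ℕₚ.≤-reflexive (expand p))
    where
    expand : ∀ p → suc (2 ℕ.* suc p) ℕ.+ (p ℕ.* p ℕ.+ 2 ℕ.* p ℕ.+ 2) ≡ suc (suc p) ℕ.* suc (suc p) ℕ.+ 1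
    expand = solve-ℕ

secondRoot-excluded : ∀ q n W → 2 ≤ q →
  let U = + (q ^ suc (suc n)) ; e = sign (suc (suc (suc n))) in
  (U - e) * W ≢ U * (+ q * U - e) * (+ q * (+ q * U) - e)
secondRoot-excluded q zero    W 2≤q =
  subst (λ U → (U + 1ℤ) * W ≢ U * (+ q * U + 1ℤ) * (+ q * (+ q * U) + 1ℤ)) (sym (pos-^2 q))
        (secondRoot-excluded-u≡q² q W 2≤q)
secondRoot-excluded q (suc n) W 2≤q =
  secondRoot-excluded-u≥q³ (sign-±1 (suc (suc (suc (suc n))))) q (+ (q ^ suc (suc (suc n)))) W 2≤q
    (ℕₚ.^-monoʳ-≤ q {{ℕ.>-nonZero (ℕₚ.<-≤-trans ℕ.z<s 2≤q)}} {3} {suc (suc (suc n))} (s≤s (s≤s (s≤s z≤n))))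

mainTheorem6 : ∀ {c ℓ} (F : FiniteField c ℓ) (q s : ℕ)
    → IsPrimePower q → 2 < q → 3 ≤ s
    → FiniteField.order F ≡ q ^ 2
    → (Ω : List (Projective.Vec F (suc s)))
    → All (Projective.NonZero F) Ω
    → AllPairs (λ a b → ¬ Projective.Proportional F a b) Ω
    → Ω ≢ []
    → (∀ (x : Projective.Vec F (suc s)) → Projective.NonZero F x
        → (+ Projective.countThrough F Ω x * + (suc q) ≡ + (q ^ s) * (+ (q ^ (s ∸ 1)) - sign (s ∸ 1)))
          ⊎ (+ Projective.countThrough F Ω x * + (suc q) ≡ + (q ^ (s ∸ 1)) * (+ (q ^ s) - sign s)))
    → + length Ω * + (suc q) ≡ + (q ^ s) * (+ (q ^ (suc s)) + sign s)
mainTheorem6 F q _ _ 2<q (s≤s (s≤s (s≤s (z≤n {n})))) order≡q² Ω Ω≢0 Ω-indep _ through =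
  Sum.[ (λ firstRoot → trans firstRoot (sym (cong₂ (λ a b → a * (b + e)) q^s≡ q^[1+s]≡)))
      , (λ secondRoot → ⊥-elim (secondRoot-excluded q n (+ length Ω * + suc q) 2≤q secondRoot)) ]
    (standardEquation-roots (sign-±1 s) (+ q) U (+ length Ω) (u+e≢0 (sign-±1 s) _ (2≤q^[1+k] q (suc n) 2≤q)) equation)
  where
  open Counting F using (Q; standardEquation)
  s = suc (suc (suc n))
  U = + (q ^ suc (suc n))
  e = sign s
  2≤q = ℕₚ.<⇒≤ 2<q
  q^s≡ : + (q ^ s) ≡ + q * U
  q^s≡ = ℤₚ.pos-* q (q ^ suc (suc n))
  q^[1+s]≡ : + (q ^ suc s) ≡ + q * (+ q * U)
  q^[1+s]≡ = trans (ℤₚ.pos-* q (q ^ s)) (cong (_*_ (+ q)) q^s≡)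
  through′ : ∀ x → Projective.NonZero F x →
    + Projective.countThrough F Ω x * + suc q ≡ + q * U * (U + e) ⊎ + Projective.countThrough F Ω x * + suc q ≡ U * (+ q * U - e)
  through′ x x≢0 = Sum.map (λ h → trans h (cong₂ _*_ q^s≡ (cong (_+_ U) (sym (ℤₚ.-1*i≡-i (sign (suc (suc n))))))))
                           (λ h → trans h (cong (λ a → U * (a - e)) q^s≡))
                           (through x x≢0)
  equation : StandardEquation (+ suc q) (+ q * U * (U + e)) (U * (+ q * U - e)) (+ length Ω) (+ q * + q) (U * U)
  equation = subst₂ (StandardEquation (+ suc q) _ _ (+ length Ω))
                    Q≡ (trans (cong (ℤ._^ suc (suc n)) Q≡) (pos-square-^ q (suc (suc n))))
                    (standardEquation (suc (suc n)) Ω Ω≢0 Ω-indep (+ suc q) _ _ through′)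
    where
    Q≡ : Q ≡ + q * + q
    Q≡ = trans (cong +_ order≡q²) (pos-^2 q)
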